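{- Let $G$ be a connected unit interval graph with lower bounds $\mathrm{lbound}:V(G)\to\mathbb{Q}\cup\{ -\infty\}$, and let $G'$, $\mathcal{R}'$, and the positions $\ell_i$ be as defined in the context. Then for every group $\Gamma_\ell$ with $\ell>1$ and every $v_i\in\Gamma_\ell$, $\ell_{\gamma_{\ell-1}}<\ell_i\le\ell_{\gamma_\ell}$, where $\ell_{\gamma_a}$ denotes the position of $\gamma_a$ in $\mathcal{R}'$.
   Context: A unit interval representation is an assignment of reals $\ell_v$ with $uv$ an edge iff $|\ell_u-\ell_v|\le1$. Vertices $u,v$ of $G$ are indistinguishable if $N[u]=N[v]$. Fix a partial order $<$ on $V(G)$ in which distinct vertices are comparable iff they are not indistinguishable and which is the left-to-right order of some unit interval representation of $G$. Let $\Gamma_1,\dots,\Gamma_k$ be the classes of indistinguishable vertices, ordered from left to right by $<$. The pruned graph $G'$ has vertices $\gamma_1,\dots,\gamma_k$, with $\gamma_a\gamma_b\in E(G')$ iff there are edges between $\Gamma_a$ and $\Gamma_b$ in $G$, and $\mathrm{lbound}(\gamma_a)=\max\{\mathrm{lbound}(v):v\in\Gamma_a\}$; order $\gamma_1<\dots<\gamma_k$. Fix $\varepsilon=1/K$ ($K$ a positive integer). Let $\mathcal{R}'=(\ell_{\gamma_a})$ be the left-most representation of $G'$, i.e. the $\varepsilon$-grid unit interval representation (all positions in $\varepsilon\mathbb{Z}$) with $\ell_{\gamma_a}<\ell_{\gamma_b}$ for $a<b$ and $\ell_{\gamma_a}\ge\mathrm{lbound}(\gamma_a)$, which is coordinatewise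 smallest among all such representations. For each $\ell$, let $\gamma^\ell_\leftarrow$ be the largest-index $\gamma_a$ with $a<\ell$ not adjacent to $\gamma_\ell$ (if any), and let $\gamma^\ell_\rightarrow$ be the largest-index $\gamma_b$ with $b\ge\ell$ such that $b=\ell$ or $\gamma_b$ is adjacent to $\gamma_\ell$. For each $v_i\in\Gamma_\ell$ set $\ell_i=\max\{\mathrm{lbound}(v_i),\ \ell_{\gamma^\ell_\leftarrow}+1+\varepsilon,\ \ell_{\gamma^\ell_\rightarrow}-1\}$, where the middle term is omitted if $\gamma^\ell_\leftarrow$ does not exist.
   Formalization: The unit interval representation of G whose left-to-right order is < is taken with rational positions instead of real ones. -}

module Defs where

open import Data.Nat as ℕ using (ℕ; zero; suc; NonZero)
open import Data.Integer as ℤ using (ℤ; +_)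
open import Data.Rational as ℚ using (ℚ; _≤_; _<_; _+_; _-_; ∣_∣; _⊔_; 1ℚ)
open import Data.Fin as Fin using (Fin; toℕ)
open import Data.Fin.Properties using (_≟_)
open import Data.Bool using (Bool; true; false; _∧_; _∨_; not; if_then_else_; T)
open import Data.Maybe using (Maybe; just; nothing; fromMaybe)
open import Data.List using (List; foldr; map; filter; allFin)
open import Data.Product using (Σ; ∃; _×_; _,_)
open import Data.Sum using (_⊎_)
open import Data.Unit using (⊤)
open import Data.Empty using (⊥)
open import Relation.Nullary using (¬_; does)
open import Relation.Binary.PropositionalEquality using (_≡_; _≢_)
open import Function.Bundles using (_⇔_)

record SimpleGraph (n : ℕ) : Set where
  field
    E     : Fin n → Fin n → Bool
    sym   : ∀ u v → E u v ≡ E v u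
    loopless : ∀ v → E v v ≡ false
open SimpleGraph public

data Reachable {n} (G : SimpleGraph n) : Fin n → Fin n → Set where
  here : ∀ {v} → Reachable G v v
  step : ∀ {u v w} → T (E G u v) → Reachable G v w → Reachable G u w

Connected : ∀ {n} → SimpleGraph n → Set
Connected G = ∀ u v → Reachable G u v

InClosedNbhd : ∀ {n} → SimpleGraph n → Fin n → Fin n → Set
InClosedNbhd G u w = (w ≡ u) ⊎ T (E G u w)

Indist : ∀ {n} → SimpleGraph n → Fin n → Fin n → Set
Indist G u v = ∀ w → InClosedNbhd G u w ⇔ InClosedNbhd G v w

IsUIR : ∀ {n} → SimpleGraph n → (Fin n → ℚ) → Set
IsUIR G r = ∀ u v → u ≢ v → (T (E G u v) ⇔ (∣ r u - r v ∣ ≤ 1ℚ))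

-- Lower bounds in ℚ ∪ {-∞}: nothing represents -∞.

maxM : Maybe ℚ → Maybe ℚ → Maybe ℚ
maxM nothing  y        = y
maxM (just x) nothing  = just x
maxM (just x) (just y) = just (x ⊔ y)

_≥ᴹ_ : ℚ → Maybe ℚ → Set
q ≥ᴹ nothing = ⊤
q ≥ᴹ just b  = b ≤ q

maxQM : Maybe ℚ → ℚ → ℚ
maxQM nothing  q = q
maxQM (just b) q = b ⊔ q

-- Pruned graph, given the class map cls : Fin n → Fin k
-- (vertex v lies in group Γ_{cls v}).

module Pruned {n k : ℕ} (G : SimpleGraph n) (cls : Fin n → Fin k)
              (lbound : Fin n → Maybe ℚ) where

  inClass : Fin k → Fin n → Bool
  inClass a v = does (cls v ≟ a)

  anyL : ∀ {A : Set} → (A → Bool) → List A → Bool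
  anyL p = foldr (λ x acc → p x ∨ acc) false

  adj' : Fin k → Fin k → Bool
  adj' a b = not (does (a ≟ b)) ∧
             anyL (λ u → anyL (λ v → inClass a u ∧ inClass b v ∧ E G u v)
                              (allFin n))
                  (allFin n)

  lboundγ : Fin k → Maybe ℚ
  lboundγ a = foldr maxM nothing (map lbound (filter (λ v → cls v ≟ a) (allFin n)))

  -- ε-grid with ε = 1/K
  OnGrid : (K : ℕ) → .{{NonZero K}} → ℚ → Set
  OnGrid K q = Σ ℤ λ z → q ≡ z ℚ./ K

  ValidRep' : (K : ℕ) → .{{NonZero K}} → (Fin k → ℚ) → Set
  ValidRep' K p =
      (∀ a → OnGrid K (p a))
    × (∀ a b → a ≢ b → (T (adj' a b) ⇔ (∣ p a - p b ∣ ≤ 1ℚ)))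
    × (∀ a b → a Fin.< b → p a < p b)
    × (∀ a → p a ≥ᴹ lboundγ a)

  IsLeftmost : (K : ℕ) → .{{NonZero K}} → (Fin k → ℚ) → Set
  IsLeftmost K p = ValidRep' K p × (∀ q → ValidRep' K q → ∀ a → p a ≤ q a)

  lastWhere : (Fin k → Bool) → Maybe (Fin k)
  lastWhere P = foldr pick nothing (allFin k)
    where
      pick : Fin k → Maybe (Fin k) → Maybe (Fin k)
      pick a (just b) = just b
      pick a nothing  = if P a then just a else nothing

  γ← : Fin k → Maybe (Fin k)
  γ← l = lastWhere (λ a → (toℕ a ℕ.<ᵇ toℕ l) ∧ not (adj' a l))

  -- γ^ℓ_→: largest b ≥ ℓ with b = ℓ or γ_b adjacent to γ_ℓ (always exists)
  γ→ : Fin k → Fin k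
  γ→ l = fromMaybe l
           (lastWhere (λ b → (toℕ l ℕ.≤ᵇ toℕ b) ∧ (does (b ≟ l) ∨ adj' l b)))

  pos : (K : ℕ) → .{{NonZero K}} → (Fin k → ℚ) → Fin n → ℚ
  pos K p v = maxQM (lbound v) (leftTerm (γ← (cls v)))
    where
      rightTerm : ℚ
      rightTerm = p (γ→ (cls v)) - 1ℚ
      leftTerm : Maybe (Fin k) → ℚ
      leftTerm nothing  = rightTerm
      leftTerm (just a) = (p a + 1ℚ + (+ 1) ℚ./ K) ⊔ rightTerm

-- Write ℓ_a for the position of γ_a in R′. As R′ is increasing, for a ≤ b the
-- classes γ_a and γ_b are equal or adjacent exactly when ℓ_b ≤ ℓ_a + 1.
-- Upper bound: every term in the definition of ℓ_i is at most ℓ_l. Indeed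
-- lbound(v_i) ≤ lbound(γ_l) ≤ ℓ_l; γ^l_→ is equal or adjacent to γ_l, so
-- ℓ_{γ^l_→} - 1 ≤ ℓ_l; and γ^l_← is a non-neighbour left of γ_l, so
-- ℓ_l > ℓ_{γ^l_←} + 1, which on the grid εℤ improves to ℓ_l ≥ ℓ_{γ^l_←} + 1 + ε.
-- Lower bound: Γ_{l-1} ≠ Γ_l, so some γ_c is equal or adjacent to exactly one of
-- γ_{l-1}, γ_l. Since neighbourhoods are intervals, either c ≤ l-1 and γ_c is a
-- non-neighbour of γ_l close to γ_{l-1}, so γ^l_← exists with index ≥ c and
-- ℓ_{l-1} ≤ ℓ_c + 1 ≤ ℓ_{γ^l_←} + 1 < ℓ_i; or c ≥ l and γ_c is close to γ_l but
-- not to γ_{l-1}, so ℓ_{l-1} < ℓ_c - 1 ≤ ℓ_{γ^l_→} - 1 ≤ ℓ_i.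
module Submission where

open import Defs
open import Data.Nat using (ℕ; suc; NonZero)
import Data.Nat
open import Data.Rational using (ℚ; _≤_; _<_)
open import Data.Fin using (Fin; toℕ)
open import Data.Maybe using (Maybe)
open import Data.Product using (Σ; _×_)
open import Data.Sum using (_⊎_)
open import Relation.Nullary using (¬_)
open import Relation.Binary.PropositionalEquality using (_≡_; _≢_)
open import Function.Bundles using (_⇔_)

open import Data.Bool using (Bool; true; false; _∧_; _∨_; not; if_then_else_; T)
open import Data.Bool.Properties using (T-∧; T-∨)
open import Data.Empty using (⊥-elim)
import Data.Fin as Fin
open import Data.Fin.Properties using (_≟_; ¬∀⟶∃¬; toℕ-injective)
open import Data.Integer as ℤ using (+_)
import Data.Integer.Properties as ℤP
open import Data.Integer.Tactic.RingSolver using (solve-∀)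
open import Data.List using ([]; _∷_; foldr; tabulate; allFin)
open import Data.List.Membership.Propositional using (_∈_; lose)
open import Data.List.Membership.Propositional.Properties using (∈-allFin; ∈-map⁺; ∈-filter⁺)
open import Data.List.Relation.Unary.Any as Any using (Any; here; there)
open import Data.Maybe using (just; nothing)
open import Data.Nat as ℕ using (zero; z≤n; s≤s)
import Data.Nat.Properties as ℕP
open import Data.Product using (∃; ∃₂; _,_; proj₁; proj₂)
open import Data.Rational as ℚ using (_+_; _-_; ∣_∣; 0ℚ; 1ℚ; _/_; toℚᵘ)
import Data.Rational.Properties as ℚP
open import Data.Rational.Solver using (module +-*-Solver)
open import Data.Rational.Unnormalised as ℚᵘ using (mkℚᵘ; *≡*; *≤*; *<*)
import Data.Rational.Unnormalised.Properties as ℚᵘP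
open import Data.Sum using (inj₁; inj₂)
open import Data.Unit using (tt)
open import Function using (id; _∘_)
open import Function.Bundles using (Equivalence; mk⇔)
open import Relation.Binary.PropositionalEquality using (refl; cong; subst; subst₂) renaming (sym to ≡-sym)
open import Relation.Nullary using (Dec; yes; no; does)
open import Relation.Nullary.Decidable using (T?; _×-dec_; _→-dec_)

open Equivalence using (to; from)

T-does : ∀ {A : Set} (d : Dec A) → T (does d) ⇔ A
T-does (yes a) = mk⇔ (λ _ → a) (λ _ → tt)
T-does (no ¬a) = mk⇔ (λ ()) ¬a

T-not : ∀ {b} → T (not b) ⇔ (¬ T b)
T-not {true}  = mk⇔ (λ ()) (λ ¬t → ¬t tt)
T-not {false} = mk⇔ (λ _ ()) (λ _ → tt)

¬⇔⇒xor : ∀ {A B : Set} → Dec A → Dec B → ¬ ((A → B) × (B → A)) → (A × ¬ B) ⊎ (B × ¬ A)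
¬⇔⇒xor (yes a) (yes b) ¬⇔ = ⊥-elim (¬⇔ ((λ _ → b) , (λ _ → a)))
¬⇔⇒xor (yes a) (no ¬b) _  = inj₁ (a , ¬b)
¬⇔⇒xor (no ¬a) (yes b) _  = inj₂ (b , ¬a)
¬⇔⇒xor (no ¬a) (no ¬b) ¬⇔ = ⊥-elim (¬⇔ ((λ a → ⊥-elim (¬a a)) , (λ b → ⊥-elim (¬b b))))

module _ where
  open +-*-Solver

  p-q≤r⇔p≤q+r : ∀ p q r → p - q ≤ r ⇔ p ≤ q + r
  p-q≤r⇔p≤q+r p q r = mk⇔
    (λ h → subst₂ _≤_ (cancel p q) (ℚP.+-comm r q) (ℚP.+-monoˡ-≤ q h))
    (λ h → subst (p - q ≤_) (shift q r) (ℚP.+-monoˡ-≤ (ℚ.- q) h))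
    where
    cancel : ∀ p q → p - q + q ≡ p
    cancel = solve 2 (λ p q → p :- q :+ q := p) refl
    shift : ∀ q r → q + r - q ≡ r
    shift = solve 2 (λ q r → q :+ r :- q := r) refl

  q+r<p⇒q<p-r : ∀ p q r → q + r < p → q < p - r
  q+r<p⇒q<p-r p q r h = subst (_< p - r) (cancel q r) (ℚP.+-monoˡ-< (ℚ.- r) h)
    where
    cancel : ∀ q r → q + r - r ≡ q
    cancel = solve 2 (λ q r → q :+ r :- r := q) refl

  ∣p-q∣≡q-p : ∀ {p q} → p ≤ q → ∣ p - q ∣ ≡ q - p
  ∣p-q∣≡q-p {p} {q} p≤q = begin
    ∣ p - q ∣       ≡⟨ cong ∣_∣ (negate p q) ⟩
    ∣ ℚ.- (q - p) ∣ ≡⟨ ℚP.∣-p∣≡∣p∣ (q - p) ⟩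
    ∣ q - p ∣       ≡⟨ ℚP.0≤p⇒∣p∣≡p 0≤q-p ⟩
    q - p           ∎
    where
    open Relation.Binary.PropositionalEquality.≡-Reasoning
    negate : ∀ p q → p - q ≡ ℚ.- (q - p)
    negate = solve 2 (λ p q → p :- q := :- (q :- p)) refl
    0≤q-p : 0ℚ ≤ q - p
    0≤q-p = subst (_≤ q - p) (ℚP.+-inverseʳ p) (ℚP.+-monoˡ-≤ (ℚ.- p) p≤q)

p-r≤q⇔p≤q+r : ∀ p q r → p - r ≤ q ⇔ p ≤ q + r
p-r≤q⇔p≤q+r p q r = subst (λ s → p - r ≤ q ⇔ p ≤ s) (ℚP.+-comm r q) (p-q≤r⇔p≤q+r p r q)

p<p+q : ∀ p {q} → 0ℚ < q → p < p + q
p<p+q p 0<q = subst (_< p + _) (ℚP.+-identityʳ p) (ℚP.+-monoʳ-< p 0<q)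

p≤p+1 : ∀ p → p ≤ p + 1ℚ
p≤p+1 p = ℚP.<⇒≤ (p<p+q p (ℚP.positive⁻¹ 1ℚ))

1/K>0 : ∀ K .{{_ : NonZero K}} → 0ℚ < + 1 / K
1/K>0 K = ℚP.positive⁻¹ (+ 1 / K) {{ℚP.normalize-pos 1 K}}

module _ (k : ℕ) where
  private
    K = + suc k

  mkℚᵘ-+ : ∀ i j → mkℚᵘ i k ℚᵘ.+ mkℚᵘ j k ℚᵘ.≃ mkℚᵘ (i ℤ.+ j) k
  mkℚᵘ-+ i j = *≡* (eq i j K)
    where
    eq : ∀ i j K → (i ℤ.* K ℤ.+ j ℤ.* K) ℤ.* K ≡ (i ℤ.+ j) ℤ.* (K ℤ.* K)
    eq = solve-∀

  1ℚᵘ≃mkℚᵘ : ℚᵘ.1ℚᵘ ℚᵘ.≃ mkℚᵘ K k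
  1ℚᵘ≃mkℚᵘ = *≡* (ℤP.*-comm (+ 1) K)

  mkℚᵘ-cancel-< : ∀ {i j} → mkℚᵘ i k ℚᵘ.< mkℚᵘ j k → i ℤ.< j
  mkℚᵘ-cancel-< (*<* h) = ℤP.*-cancelʳ-<-nonNeg K h

  mkℚᵘ-mono-≤ : ∀ {i j} → i ℤ.≤ j → mkℚᵘ i k ℚᵘ.≤ mkℚᵘ j k
  mkℚᵘ-mono-≤ h = *≤* (ℤP.*-monoʳ-≤-nonNeg K h)

grid-gap : ∀ K .{{_ : NonZero K}} z w → z / K + 1ℚ < w / K → z / K + 1ℚ + + 1 / K ≤ w / K
grid-gap (suc k) z w h = ℚP.toℚᵘ-cancel-≤ (begin
  toℚᵘ (a + 1ℚ + ε)                      ≃⟨ ℚP.toℚᵘ-homo-+ (a + 1ℚ) ε ⟩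
  toℚᵘ (a + 1ℚ) ℚᵘ.+ toℚᵘ ε              ≃⟨ ℚᵘP.+-cong a+1 (ℚP.toℚᵘ-fromℚᵘ (mkℚᵘ (+ 1) k)) ⟩
  mkℚᵘ (z ℤ.+ K) k ℚᵘ.+ mkℚᵘ (+ 1) k     ≃⟨ mkℚᵘ-+ k (z ℤ.+ K) (+ 1) ⟩
  mkℚᵘ (z ℤ.+ K ℤ.+ + 1) k               ≤⟨ mkℚᵘ-mono-≤ k z+K+1≤w ⟩
  mkℚᵘ w k                               ≃⟨ ℚP.toℚᵘ-fromℚᵘ (mkℚᵘ w k) ⟨
  toℚᵘ (w / suc k)                       ∎)
  where
  open ℚᵘP.≤-Reasoning
  K = + suc k
  a = z / suc k
  ε = + 1 / suc k
  a+1 : toℚᵘ (a + 1ℚ) ℚᵘ.≃ mkℚᵘ (z ℤ.+ K) k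
  a+1 = ℚᵘP.≃-trans (ℚP.toℚᵘ-homo-+ a 1ℚ)
          (ℚᵘP.≃-trans (ℚᵘP.+-cong (ℚP.toℚᵘ-fromℚᵘ (mkℚᵘ z k)) (1ℚᵘ≃mkℚᵘ k)) (mkℚᵘ-+ k z K))
  z+K<w : z ℤ.+ K ℤ.< w
  z+K<w = mkℚᵘ-cancel-< k (ℚᵘP.<-respʳ-≃ (ℚP.toℚᵘ-fromℚᵘ (mkℚᵘ w k))
                            (ℚᵘP.<-respˡ-≃ a+1 (ℚP.toℚᵘ-mono-< h)))
  z+K+1≤w : z ℤ.+ K ℤ.+ + 1 ℤ.≤ w
  z+K+1≤w = subst (ℤ._≤ w) (ℤP.+-comm (+ 1) (z ℤ.+ K)) (ℤP.i<j⇒suc[i]≤j z+K<w)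

≥ᴹ-maxM⁻ : ∀ {q} x y → q ≥ᴹ maxM x y → q ≥ᴹ x × q ≥ᴹ y
≥ᴹ-maxM⁻ nothing  y        h = tt , h
≥ᴹ-maxM⁻ (just x) nothing  h = h , tt
≥ᴹ-maxM⁻ (just x) (just y) h = ℚP.≤-trans (ℚP.p≤p⊔q x y) h , ℚP.≤-trans (ℚP.p≤q⊔p x y) h

≥ᴹ-foldr-maxM⁻ : ∀ {q m xs} → q ≥ᴹ foldr maxM nothing xs → m ∈ xs → q ≥ᴹ m
≥ᴹ-foldr-maxM⁻ {xs = x ∷ _} h (here refl) = proj₁ (≥ᴹ-maxM⁻ x _ h)
≥ᴹ-foldr-maxM⁻ {xs = x ∷ _} h (there m∈xs) = ≥ᴹ-foldr-maxM⁻ (proj₂ (≥ᴹ-maxM⁻ x _ h)) m∈xs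

maxQM-lub : ∀ {q} b t → q ≥ᴹ b → t ≤ q → maxQM b t ≤ q
maxQM-lub nothing  t _   t≤q = t≤q
maxQM-lub (just b) t b≤q t≤q = ℚP.⊔-lub b≤q t≤q

t≤maxQM : ∀ b t → t ≤ maxQM b t
t≤maxQM nothing  t = ℚP.≤-refl
t≤maxQM (just b) t = ℚP.p≤q⊔p b t

module _ {A : Set} (P : A → Bool) where

  data IsLast {m} (h : Fin m → A) : Maybe A → Set where
    none : (∀ i → ¬ T (P (h i))) → IsLast h nothing
    last : ∀ j → T (P (h j)) → (∀ i → T (P (h i)) → i Fin.≤ j) → IsLast h (just (h j))

  -- pick is abstracted by its two defining equations, so that the lemma applies
  -- to the (unnameable) local function of lastWhere.
  foldr-isLast : (pick : A → Maybe A → Maybe A) →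
                 (∀ a b → pick a (just b) ≡ just b) →
                 (∀ a → pick a nothing ≡ (if P a then just a else nothing)) →
                 ∀ {m} (h : Fin m → A) → IsLast h (foldr pick nothing (tabulate h))
  foldr-isLast pick pick-just pick-nothing = go
    where
    go : ∀ {m} (h : Fin m → A) → IsLast h (foldr pick nothing (tabulate h))
    go {zero}  h = none λ ()
    go {suc m} h with foldr pick nothing (tabulate (h ∘ Fin.suc)) | go (h ∘ Fin.suc)
    ... | just _  | last j Pj maximal =
      subst (IsLast h) (≡-sym (pick-just _ _))
        (last (Fin.suc j) Pj λ { Fin.zero _ → z≤n ; (Fin.suc i) Pi → s≤s (maximal i Pi) })
    ... | nothing | none ¬P =
      subst (IsLast h) (≡-sym (pick-nothing (h Fin.zero))) (first (P (h Fin.zero)) refl)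
      where
      first : ∀ b → P (h Fin.zero) ≡ b → IsLast h (if b then just (h Fin.zero) else nothing)
      first true  P₀ = last Fin.zero (subst T (≡-sym P₀) tt)
                         λ { Fin.zero _ → z≤n ; (Fin.suc i) Pi → ⊥-elim (¬P i Pi) }
      first false P₀ = none λ { Fin.zero P₀′ → subst T P₀ P₀′ ; (Fin.suc i) → ¬P i }

module PrunedGraph {n k : ℕ} (G : SimpleGraph n) (cls : Fin n → Fin k)
                   (lbound : Fin n → Maybe ℚ) where
  open Pruned G cls lbound

  T-anyL : ∀ {A : Set} (q : A → Bool) xs → T (anyL q xs) ⇔ Any (T ∘ q) xs
  T-anyL q []       = mk⇔ (λ ()) (λ ())
  T-anyL q (x ∷ xs) = mk⇔ to′ from′
    where
    to′ : T (q x ∨ anyL q xs) → Any (T ∘ q) (x ∷ xs)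
    to′ t with to T-∨ t
    ... | inj₁ qx = here qx
    ... | inj₂ qxs = there (to (T-anyL q xs) qxs)
    from′ : Any (T ∘ q) (x ∷ xs) → T (q x ∨ anyL q xs)
    from′ (here qx)   = from T-∨ (inj₁ qx)
    from′ (there qxs) = from (T-∨ {q x}) (inj₂ (from (T-anyL q xs) qxs))

  T-anyL-allFin : ∀ {m} (q : Fin m → Bool) → T (anyL q (allFin m)) ⇔ ∃ (T ∘ q)
  T-anyL-allFin q = mk⇔ (Any.satisfied ∘ to (T-anyL q (allFin _)))
                        (λ (x , qx) → from (T-anyL q (allFin _)) (lose (∈-allFin x) qx))

  T-inClass : ∀ a v → T (inClass a v) ⇔ (cls v ≡ a)
  T-inClass a v = T-does (cls v ≟ a)

  EdgeBetween : Fin k → Fin k → Set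
  EdgeBetween a b = ∃₂ λ u w → cls u ≡ a × cls w ≡ b × T (E G u w)

  adj'⇔ : ∀ a b → T (adj' a b) ⇔ (a ≢ b × EdgeBetween a b)
  adj'⇔ a b = mk⇔ to′ from′
    where
    to′ : T (adj' a b) → a ≢ b × EdgeBetween a b
    to′ t with to T-∧ t
    ... | a≉b , edge with to (T-anyL-allFin _) edge
    ... | u , edge′ with to (T-anyL-allFin _) edge′
    ... | w , uwE with to T-∧ uwE
    ... | u∈a , wE with to T-∧ wE
    ... | w∈b , uw =
      to T-not a≉b ∘ from (T-does (a ≟ b)) ,
      u , w , to (T-inClass a u) u∈a , to (T-inClass b w) w∈b , uw
    from′ : a ≢ b × EdgeBetween a b → T (adj' a b)
    from′ (a≢b , u , w , u∈a , w∈b , uw) =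
      from T-∧ (from T-not (a≢b ∘ to (T-does (a ≟ b))) ,
        from (T-anyL-allFin _) (u , from (T-anyL-allFin _) (w ,
          from T-∧ (from (T-inClass a u) u∈a , from T-∧ (from (T-inClass b w) w∈b , uw)))))

  adj'-sym : ∀ {a b} → T (adj' a b) → T (adj' b a)
  adj'-sym {a} {b} t with to (adj'⇔ a b) t
  ... | a≢b , u , w , u∈a , w∈b , uw =
    from (adj'⇔ b a) (a≢b ∘ ≡-sym , w , u , w∈b , u∈a , subst T (SimpleGraph.sym G u w) uw)

  Close : Fin k → Fin k → Set
  Close a b = a ≡ b ⊎ T (adj' a b)

  close-sym : ∀ {a b} → Close a b → Close b a
  close-sym (inj₁ a≡b) = inj₁ (≡-sym a≡b)
  close-sym (inj₂ adj) = inj₂ (adj'-sym adj)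

  inClosedNbhd-sym : ∀ {u w} → InClosedNbhd G u w → InClosedNbhd G w u
  inClosedNbhd-sym (inj₁ w≡u) = inj₁ (≡-sym w≡u)
  inClosedNbhd-sym {u} {w} (inj₂ uw) = inj₂ (subst T (SimpleGraph.sym G u w) uw)

  inClosedNbhd? : ∀ u w → Dec (InClosedNbhd G u w)
  inClosedNbhd? u w with w ≟ u | T? (E G u w)
  ... | yes w≡u | _       = yes (inj₁ w≡u)
  ... | no _    | yes uw  = yes (inj₂ uw)
  ... | no w≢u  | no ¬uw  = no λ { (inj₁ w≡u) → w≢u w≡u ; (inj₂ uw) → ¬uw uw }

  module _ (clsIff : ∀ u v → (cls u ≡ cls v) ⇔ Indist G u v) where

    inClosedNbhd⇔close : ∀ u x → InClosedNbhd G u x ⇔ Close (cls u) (cls x)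
    inClosedNbhd⇔close u x = mk⇔ to′ from′
      where
      to′ : InClosedNbhd G u x → Close (cls u) (cls x)
      to′ (inj₁ x≡u) = inj₁ (cong cls (≡-sym x≡u))
      to′ (inj₂ ux) = edge⇒close (cls u ≟ cls x) ux
        where
        edge⇒close : Dec (cls u ≡ cls x) → T (E G u x) → Close (cls u) (cls x)
        edge⇒close (yes u∼x) _  = inj₁ u∼x
        edge⇒close (no u≁x)  ux = inj₂ (from (adj'⇔ _ _) (u≁x , u , x , refl , refl , ux))
      from′ : Close (cls u) (cls x) → InClosedNbhd G u x
      from′ (inj₁ u∼x) = from (to (clsIff u x) u∼x x) (inj₁ refl)
      from′ (inj₂ adj) with to (adj'⇔ _ _) adj
      ... | _ , u′ , x′ , u′∼u , x′∼x , u′x′ =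
        inClosedNbhd-sym (to (to (clsIff x′ x) x′∼x u)
          (inClosedNbhd-sym (to (to (clsIff u′ u) u′∼u x′) (inj₂ u′x′))))

    separating-class : ∀ {u w} → cls u ≢ cls w →
      ∃ λ c → (Close (cls u) c × ¬ Close (cls w) c) ⊎ (Close (cls w) c × ¬ Close (cls u) c)
    separating-class {u} {w} u≁w with ¬∀⟶∃¬ n Agree agree? (u≁w ∘ from (clsIff u w) ∘ indist)
      where
      Agree : Fin n → Set
      Agree x = (InClosedNbhd G u x → InClosedNbhd G w x) × (InClosedNbhd G w x → InClosedNbhd G u x)
      agree? : ∀ x → Dec (Agree x)
      agree? x = (inClosedNbhd? u x →-dec inClosedNbhd? w x) ×-dec (inClosedNbhd? w x →-dec inClosedNbhd? u x)
      indist : (∀ x → Agree x) → Indist G u w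
      indist agree x = mk⇔ (proj₁ (agree x)) (proj₂ (agree x))
    ... | x , disagree with ¬⇔⇒xor (inClosedNbhd? u x) (inClosedNbhd? w x) disagree
    ... | inj₁ (ux , ¬wx) = cls x , inj₁ (to (inClosedNbhd⇔close u x) ux , ¬wx ∘ from (inClosedNbhd⇔close w x))
    ... | inj₂ (wx , ¬ux) = cls x , inj₂ (to (inClosedNbhd⇔close w x) wx , ¬ux ∘ from (inClosedNbhd⇔close u x))

  leftCandidate : Fin k → Fin k → Bool
  leftCandidate l a = (toℕ a ℕ.<ᵇ toℕ l) ∧ not (adj' a l)

  rightCandidate : Fin k → Fin k → Bool
  rightCandidate l b = (toℕ l ℕ.≤ᵇ toℕ b) ∧ (does (b ≟ l) ∨ adj' l b)

  T-leftCandidate : ∀ l a → T (leftCandidate l a) ⇔ (toℕ a ℕ.< toℕ l × ¬ T (adj' a l))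
  T-leftCandidate l a = mk⇔
    (λ t → let a<l , ¬adj = to T-∧ t in ℕP.<ᵇ⇒< _ _ a<l , to T-not ¬adj)
    (λ (a<l , ¬adj) → from T-∧ (ℕP.<⇒<ᵇ a<l , from T-not ¬adj))

  T-rightCandidate : ∀ l b → T (rightCandidate l b) ⇔ (toℕ l ℕ.≤ toℕ b × Close l b)
  T-rightCandidate l b = mk⇔
    (λ t → let l≤b , close = to T-∧ t in ℕP.≤ᵇ⇒≤ _ _ l≤b , toClose (to T-∨ close))
    (λ (l≤b , close) → from T-∧ (ℕP.≤⇒≤ᵇ l≤b , fromClose close))
    where
    toClose : T (does (b ≟ l)) ⊎ T (adj' l b) → Close l b
    toClose (inj₁ b≡l) = inj₁ (≡-sym (to (T-does (b ≟ l)) b≡l))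
    toClose (inj₂ adj) = inj₂ adj
    fromClose : Close l b → T (does (b ≟ l) ∨ adj' l b)
    fromClose (inj₁ l≡b) = from T-∨ (inj₁ (from (T-does (b ≟ l)) (≡-sym l≡b)))
    fromClose (inj₂ adj) = from (T-∨ {does (b ≟ l)}) (inj₂ adj)

  γ←-isLast : ∀ l → IsLast (leftCandidate l) id (γ← l)
  γ←-isLast l = foldr-isLast (leftCandidate l) _ (λ _ _ → refl) (λ _ → refl) id

  γ→-isLast : ∀ l → IsLast (rightCandidate l) id (lastWhere (rightCandidate l))
  γ→-isLast l = foldr-isLast (rightCandidate l) _ (λ _ _ → refl) (λ _ → refl) id

  γ→-spec : ∀ l → toℕ l ℕ.≤ toℕ (γ→ l) × Close l (γ→ l)
  γ→-spec l with lastWhere (rightCandidate l) | γ→-isLast l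
  ... | nothing | none _ = ℕP.≤-refl , inj₁ refl
  ... | just _  | last j cand _ = to (T-rightCandidate l j) cand

  γ→-maximal : ∀ {l c} → toℕ l ℕ.≤ toℕ c → Close l c → toℕ c ℕ.≤ toℕ (γ→ l)
  γ→-maximal {l} {c} l≤c close with lastWhere (rightCandidate l) | γ→-isLast l
  ... | nothing | none ¬cand = ⊥-elim (¬cand c (from (T-rightCandidate l c) (l≤c , close)))
  ... | just _  | last _ _ maximal = maximal c (from (T-rightCandidate l c) (l≤c , close))

  γ←-maximal : ∀ {l c} → toℕ c ℕ.< toℕ l → ¬ T (adj' c l) →
               ∃ λ a → γ← l ≡ just a × toℕ c ℕ.≤ toℕ a
  γ←-maximal {l} {c} c<l ¬adj with γ← l | γ←-isLast l
  ... | nothing | none ¬cand = ⊥-elim (¬cand c (from (T-leftCandidate l c) (c<l , ¬adj)))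
  ... | just _  | last a _ maximal = a , refl , maximal c (from (T-leftCandidate l c) (c<l , ¬adj))

  module Positions (K : ℕ) .{{_ : NonZero K}} (p : Fin k → ℚ) (valid : ValidRep' K p) where

    ε : ℚ
    ε = + 1 / K

    private
      onGrid      = proj₁ valid
      adj⇔near    = proj₁ (proj₂ valid)
      increasing  = proj₁ (proj₂ (proj₂ valid))
      aboveLbound = proj₂ (proj₂ (proj₂ valid))

    increasing-≤ : ∀ {a b} → toℕ a ℕ.≤ toℕ b → p a ≤ p b
    increasing-≤ {a} {b} a≤b with ℕP.m≤n⇒m<n∨m≡n a≤b
    ... | inj₁ a<b = ℚP.<⇒≤ (increasing a b a<b)
    ... | inj₂ a≡b = ℚP.≤-reflexive (cong p (toℕ-injective a≡b))

    close⇔ : ∀ {a b} → toℕ a ℕ.≤ toℕ b → Close a b ⇔ p b ≤ p a + 1ℚ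
    close⇔ {a} {b} a≤b = byCases (a ≟ b)
      where
      distance : ∣ p a - p b ∣ ≡ p b - p a
      distance = ∣p-q∣≡q-p (increasing-≤ a≤b)
      byCases : Dec (a ≡ b) → Close a b ⇔ p b ≤ p a + 1ℚ
      byCases (yes refl) = mk⇔ (λ _ → p≤p+1 (p a)) (λ _ → inj₁ refl)
      byCases (no a≢b)   = mk⇔ to′ from′
        where
        to′ : Close a b → p b ≤ p a + 1ℚ
        to′ (inj₁ a≡b) = ⊥-elim (a≢b a≡b)
        to′ (inj₂ adj) = to (p-q≤r⇔p≤q+r _ _ _) (subst (_≤ 1ℚ) distance (to (adj⇔near a b a≢b) adj))
        from′ : p b ≤ p a + 1ℚ → Close a b
        from′ h = inj₂ (from (adj⇔near a b a≢b) (subst (_≤ 1ℚ) (≡-sym distance) (from (p-q≤r⇔p≤q+r _ _ _) h)))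

    ¬close⇒far : ∀ {a b} → toℕ a ℕ.≤ toℕ b → ¬ Close a b → p a + 1ℚ < p b
    ¬close⇒far a≤b ¬close = ℚP.≰⇒> (¬close ∘ from (close⇔ a≤b))

    close-shrinkˡ : ∀ {a b c} → toℕ a ℕ.≤ toℕ b → toℕ b ℕ.≤ toℕ c → Close a c → Close b c
    close-shrinkˡ a≤b b≤c close = from (close⇔ b≤c)
      (ℚP.≤-trans (to (close⇔ (ℕP.≤-trans a≤b b≤c)) close) (ℚP.+-monoˡ-≤ 1ℚ (increasing-≤ a≤b)))

    close-shrinkʳ : ∀ {a b c} → toℕ a ℕ.≤ toℕ b → toℕ b ℕ.≤ toℕ c → Close a c → Close a b
    close-shrinkʳ a≤b b≤c close = from (close⇔ a≤b)
      (ℚP.≤-trans (increasing-≤ b≤c) (to (close⇔ (ℕP.≤-trans a≤b b≤c)) close))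

    far⇒gap : ∀ {a b} → toℕ a ℕ.≤ toℕ b → ¬ Close a b → p a + 1ℚ + ε ≤ p b
    far⇒gap {a} {b} a≤b ¬close with onGrid a | onGrid b
    ... | za , pa≡ | zb , pb≡ =
      subst₂ (λ x y → x + 1ℚ + ε ≤ y) (≡-sym pa≡) (≡-sym pb≡)
        (grid-gap K za zb (subst₂ (λ x y → x + 1ℚ < y) pa≡ pb≡ (¬close⇒far a≤b ¬close)))

    lbound≤ : ∀ v → p (cls v) ≥ᴹ lbound v
    lbound≤ v = ≥ᴹ-foldr-maxM⁻ (aboveLbound (cls v))
      (∈-map⁺ lbound (∈-filter⁺ (λ u → cls u ≟ cls v) (∈-allFin v) refl))

    rightTerm≤ : ∀ l → p (γ→ l) - 1ℚ ≤ p l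
    rightTerm≤ l = let l≤γ→ , close = γ→-spec l in
      from (p-r≤q⇔p≤q+r _ _ _) (to (close⇔ l≤γ→) close)

    pos≤ : ∀ v → pos K p v ≤ p (cls v)
    pos≤ v with γ← (cls v) | γ←-isLast (cls v)
    ... | nothing | _ = maxQM-lub (lbound v) _ (lbound≤ v) (rightTerm≤ (cls v))
    ... | just _  | last a cand _ = maxQM-lub (lbound v) _ (lbound≤ v)
      (ℚP.⊔-lub (far⇒gap (ℕP.<⇒≤ a<l) (¬adj ∘ adjacent)) (rightTerm≤ (cls v)))
      where
      a<l = proj₁ (to (T-leftCandidate (cls v) a) cand)
      ¬adj = proj₂ (to (T-leftCandidate (cls v) a) cand)
      adjacent : Close a (cls v) → T (adj' a (cls v))
      adjacent (inj₁ refl) = ⊥-elim (ℕP.<-irrefl refl a<l)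
      adjacent (inj₂ adj) = adj

    rightTerm≤pos : ∀ v → p (γ→ (cls v)) - 1ℚ ≤ pos K p v
    rightTerm≤pos v with γ← (cls v)
    ... | nothing = t≤maxQM (lbound v) _
    ... | just a  = ℚP.≤-trans (ℚP.p≤q⊔p (p a + 1ℚ + ε) _) (t≤maxQM (lbound v) _)

    leftTerm≤pos : ∀ v {a} → γ← (cls v) ≡ just a → p a + 1ℚ + ε ≤ pos K p v
    leftTerm≤pos v γ←≡a with γ← (cls v) | γ←≡a
    ... | just _ | refl = ℚP.≤-trans (ℚP.p≤p⊔q _ _) (t≤maxQM (lbound v) _)

    far-left<pos : ∀ {c} v → toℕ c ℕ.< toℕ (cls v) → ¬ Close c (cls v) → p c + 1ℚ < pos K p v
    far-left<pos {c} v c<l ¬close with γ←-maximal c<l (¬close ∘ inj₂)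
    ... | a , γ←≡a , c≤a = begin-strict
      p c + 1ℚ       ≤⟨ ℚP.+-monoˡ-≤ 1ℚ (increasing-≤ c≤a) ⟩
      p a + 1ℚ       <⟨ p<p+q _ (1/K>0 K) ⟩
      p a + 1ℚ + ε   ≤⟨ leftTerm≤pos v γ←≡a ⟩
      pos K p v      ∎
      where open ℚP.≤-Reasoning

    close-right≤pos : ∀ {c} v → toℕ (cls v) ℕ.≤ toℕ c → Close (cls v) c → p c - 1ℚ ≤ pos K p v
    close-right≤pos v l≤c close =
      ℚP.≤-trans (ℚP.+-monoˡ-≤ (ℚ.- 1ℚ) (increasing-≤ (γ→-maximal l≤c close))) (rightTerm≤pos v)

    prev<pos : (∀ u v → (cls u ≡ cls v) ⇔ Indist G u v) →
               ∀ u v → toℕ (cls v) ≡ suc (toℕ (cls u)) → p (cls u) < pos K p v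
    prev<pos clsIff u v l≡1+l′ = separate (separating-class clsIff l′≢l)
      where
      l′<l : toℕ (cls u) ℕ.< toℕ (cls v)
      l′<l = subst (toℕ (cls u) ℕ.<_) (≡-sym l≡1+l′) ℕP.≤-refl
      l′≤l = ℕP.<⇒≤ l′<l
      l′≢l : cls u ≢ cls v
      l′≢l l′≡l = ℕP.<-irrefl (cong toℕ l′≡l) l′<l
      l≤c : ∀ {c} → ¬ toℕ c ℕ.≤ toℕ (cls u) → toℕ (cls v) ℕ.≤ toℕ c
      l≤c c≰l′ = subst (ℕ._≤ _) (≡-sym l≡1+l′) (ℕP.≰⇒> c≰l′)
      separate : (∃ λ c → (Close (cls u) c × ¬ Close (cls v) c) ⊎ (Close (cls v) c × ¬ Close (cls u) c)) →
                 p (cls u) < pos K p v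
      separate (c , inj₁ (l′∼c , l≁c)) with toℕ c ℕ.≤? toℕ (cls u)
      ... | yes c≤l′ = ℚP.≤-<-trans (to (close⇔ c≤l′) (close-sym l′∼c))
                         (far-left<pos v (ℕP.≤-<-trans c≤l′ l′<l) (l≁c ∘ close-sym))
      ... | no  c≰l′ = ⊥-elim (l≁c (close-shrinkˡ l′≤l (l≤c c≰l′) l′∼c))
      separate (c , inj₂ (l∼c , l′≁c)) with toℕ c ℕ.≤? toℕ (cls u)
      ... | yes c≤l′ = ⊥-elim (l′≁c (close-sym (close-shrinkʳ c≤l′ l′≤l (close-sym l∼c))))
      ... | no  c≰l′ = ℚP.<-≤-trans (q+r<p⇒q<p-r _ _ _ (¬close⇒far (ℕP.<⇒≤ (ℕP.≰⇒> c≰l′)) l′≁c))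
                         (close-right≤pos v (l≤c c≰l′) l∼c)

mainTheorem10 : (n k : ℕ) (G : SimpleGraph n) → Connected G →
    (lbound : Fin n → Maybe ℚ) →
    (_≺_ : Fin n → Fin n → Set) →
    (∀ v → ¬ (v ≺ v)) →
    (∀ u v w → u ≺ v → v ≺ w → u ≺ w) →
    (∀ u v → u ≢ v → ((u ≺ v ⊎ v ≺ u) ⇔ (¬ Indist G u v))) →
    Σ (Fin n → ℚ) (λ r → IsUIR G r × (∀ u v → u ≺ v → r u < r v)) →
    (cls : Fin n → Fin k) →
    (∀ a → Σ (Fin n) (λ v → cls v ≡ a)) →
    (∀ u v → (cls u ≡ cls v) ⇔ Indist G u v) →
    (∀ u v → u ≺ v → toℕ (cls u) Data.Nat.< toℕ (cls v)) →
    (K : ℕ) → .{{_ : NonZero K}} →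
    (p : Fin k → ℚ) → Pruned.IsLeftmost G cls lbound K p →
    ∀ (l' l : Fin k) → toℕ l ≡ suc (toℕ l') →
    ∀ (v : Fin n) → cls v ≡ l →
    (p l' < Pruned.pos G cls lbound K p v) × (Pruned.pos G cls lbound K p v ≤ p l)
mainTheorem10 n k G _ lbound _ _ _ _ _ cls classOf clsIff _ K p (valid , _) l′ .(cls v) l≡1+l′ v refl
  with classOf l′
... | u , refl = prev<pos clsIff u v l≡1+l′ , pos≤ v
  where open PrunedGraph.Positions G cls lbound K p valid
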